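{- Let $n\in\mathbb{N}$, fix an $n$-cycle $G$, and consider a randomized canonical $q$-query partition oracle ${\bf T}$ in the General-Label-Model (with $N$ sufficiently large) using $r<\lg n - q^6$ random bits. Then there exists a set $C$ of labels such that, if the vertices of $G$ are labeled with labels from $C$, the total number of distinct indices used for label queries by ${\bf T}$, over all nodes of all decision trees in ${\bf T}$, is at most $n/q^5$.
   Context: General-Label-Model: vertices of the $n$-vertex input graph carry distinct labels from $[N]$; queries are label queries (given $i\in[n]$, return the label of the $i$-th vertex in a fixed arbitrary order) and neighbor queries (given a label and $r\le d$, return the label of the $r$-th neighbor). For a label $\ell$, $B(\ell)$ denotes the list of labels of all vertices at distance at most $q$ from the vertex with label $\ell$ (a list of $2q+1$ labels on a cycle). A canonical $q$-query partition oracle is represented by a decision tree $T$ of depth at most $q$: each node $z$ at depth $d_z$ (root has depth $1$) contains a function $f_z:\mathbb{N}^{d_z(2q+1)}\to[n]$, and edges out of $z$ correspond to its possible output indices. The oracle maintains a list of seed labels, initially the input label; at a node $z$ with seeds $\ell_1,\dots,\ell_{d_z}$, it obtains $B(\ell_1),\dots,B(\ell_{d_z})$ by neighbor queries, evaluates $f_z$ on their concatenation to get an index $i$, makes a label query with index $i$ to obtain the next seed, and moves along the edge labeled $i$; after $q$ rounds it outputs a bit (cut or not). A randomized canonical oracle using $r$ random bits is a collection ${\bf T}$ of $2^r$ such decision trees, one chosen uniformly at random. The "indices used for label queries" are the indices appearing on edges of the trees that can be reached on inputs labeled from $C$. -}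

module Defs where

open import Data.Nat using (ℕ; zero; suc; _+_; _*_; _∸_)
open import Data.Nat.DivMod using (_mod_)
open import Data.Fin using (Fin; toℕ)
open import Data.Bool using (Bool)
open import Data.Vec using (Vec; _∷ʳ_; tabulate; concat; map)
open import Function.Bundles using (_↔_; Inverse)
open import Relation.Binary.PropositionalEquality using (_≡_)

ballSize : ℕ → ℕ
ballSize q = 2 * q + 1

-- DT n q d k : a (sub)tree whose root node has depth d (so d seeds are
-- known), with at most k further rounds allowed.
-- Leaves (output bit: cut or not) may occur at any depth (depth ≤ q).
data DT (n q : ℕ) : ℕ → ℕ → Set where
  leaf : ∀ {d k} → Bool → DT n q d k
  node : ∀ {d k} → (Vec ℕ (d * ballSize q) → Fin n) →
         (Fin n → DT n q (suc d) k) → DT n q d (suc k)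

Tree : ℕ → ℕ → Set
Tree n q = DT n q 1 q

RandOracle : ℕ → ℕ → ℕ → Set
RandOracle n q r = Fin (2 Data.Nat.^ r) → Tree n q

shiftPos : ∀ {n} → Fin n → ℕ → Fin n
shiftPos {suc m} p t = (toℕ p + t) mod (suc m)

-- The n-cycle G on vertex set [n] (vertex i = i-th vertex in the fixed
-- order used by label queries) is given by a bijection cyc from cycle
-- positions to vertices: cycle edges are  to cyc j — to cyc (j+1 mod n).
-- B(v): labels of the vertices at cycle offsets -q,…,0,…,+q from v,
-- listed in cycle order (2q+1 labels).
ball : ∀ {n N} (q : ℕ) → Fin n ↔ Fin n → (Fin n → Fin N) → Fin n → Vec ℕ (ballSize q)
ball {n} q cyc L v =
  tabulate λ (k : Fin (ballSize q)) →
    toℕ (L (Inverse.to cyc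
      (shiftPos (Inverse.from cyc v) (n * q + toℕ k ∸ q))))

-- Uses cyc L t seeds i : running the (sub)tree t on graph cyc with
-- labeling L, from current seed vertices `seeds`, some node reached makes
-- a label query with index i (i.e. the edge labelled i is traversed).
-- A label query with index j returns the label of vertex j, which becomes
-- the next seed.
data Uses {n N q : ℕ} (cyc : Fin n ↔ Fin n) (L : Fin n → Fin N) :
          ∀ {d k} → DT n q d k → Vec (Fin n) d → Fin n → Set where
  here  : ∀ {d k} {f : Vec ℕ (d * ballSize q) → Fin n}
            {ch : Fin n → DT n q (suc d) k} {seeds : Vec (Fin n) d} {i : Fin n} →
          f (concat (map (ball q cyc L) seeds)) ≡ i →
          Uses cyc L (node f ch) seeds i
  there : ∀ {d k} {f : Vec ℕ (d * ballSize q) → Fin n}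
            {ch : Fin n → DT n q (suc d) k} {seeds : Vec (Fin n) d} {i : Fin n} →
          let j = f (concat (map (ball q cyc L) seeds)) in
          Uses cyc L (ch j) (seeds ∷ʳ j) i →
          Uses cyc L (node f ch) seeds i

-- Ramsey's theorem makes the oracle blind to the values of the labels. Address each node
-- of each tree by its path from the root, and each way of writing a node input with k
-- distinct labels by a pattern of positions into a k-element list. Colouring the k-element
-- sublists of [N] by the output of the node on the pattern filled in with them gives finitely
-- many colourings, independent of N, with at most n + 1 colours; for N large enough there is
-- a list H of n labels homogeneous for all of them at once. On inputs labelled from H, the
-- output of a node of arity len is then determined by the pattern of its input, of which
-- there are at most len ^ len, so a tree queries at most queryBound q 1 q indices and the
-- 2 ^ r trees together at most 2 ^ r * queryBound q 1 q ≤ n / q ^ 5.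
module Submission where

open import Data.Nat using (ℕ)

module Ramsey where

  open import Data.Nat using (ℕ; zero; suc; _+_; _*_; _≤_; z≤n; s≤s; _≟_; _≤?_)
  open import Data.Nat.Properties
  open import Data.List using (List; []; _∷_; length; map; filter; foldr)
  open import Data.List.Properties using (length-map)
  open import Data.List.Relation.Unary.All as All using (All; []; _∷_)
  open import Data.List.Relation.Unary.All.Properties using (all-filter; filter⁺)
  open import Data.List.Relation.Unary.Any using (here; there)
  open import Data.List.Membership.Propositional using (_∈_)
  open import Data.List.Relation.Binary.Sublist.Propositional
    using (_⊆_; []; _∷_; _∷ʳ_; ⊆-refl; ⊆-trans; minimum)
  open import Data.List.Relation.Binary.Sublist.Propositional.Properties using (map⁺; filter-⊆)
  open import Data.Product using (∃; _×_; _,_; proj₁; proj₂)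
  open import Function using (_∘_)
  open import Relation.Binary.PropositionalEquality using (_≡_; refl; sym; cong; subst; trans)
  open import Relation.Nullary using (yes; no; ¬?)
  open import Relation.Unary using (Decidable)

  private variable X Y J : Set

  length-filter-¬ : {P : Y → Set} (P? : Decidable P) (ys : List Y) →
                    length (filter P? ys) + length (filter (¬? ∘ P?) ys) ≡ length ys
  length-filter-¬ P? [] = refl
  length-filter-¬ P? (y ∷ ys) with P? y
  ... | yes _ = cong suc (length-filter-¬ P? ys)
  ... | no  _ = trans (+-suc _ _) (cong suc (length-filter-¬ P? ys))

  pigeonhole : (colour : Y → ℕ) (c m : ℕ) (ys : List Y) →
               All (λ y → colour y ≤ c) ys → suc c * m ≤ length ys →
               ∃ λ k → k ≤ c × ∃ λ zs → zs ⊆ ys × All (λ y → colour y ≡ k) zs × m ≤ length zs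
  pigeonhole colour zero m ys ≤0 m≤ =
    0 , z≤n , ys , ⊆-refl , All.map n≤0⇒n≡0 ≤0 , subst (_≤ length ys) (+-identityʳ m) m≤
  pigeonhole {Y} colour (suc c) m ys ≤c+1 m≤ with m ≤? length (filter (λ y → colour y ≟ suc c) ys)
  ... | yes long = suc c , ≤-refl , _ , filter-⊆ _ ys , all-filter _ ys , long
  ... | no short =
    let k , k≤c , zs , zs⊆ , mono , long = pigeonhole colour c m rest ≤c rest-long
    in k , m≤n⇒m≤1+n k≤c , zs , ⊆-trans zs⊆ (filter-⊆ _ ys) , mono , long
    where
    top? : Decidable (λ y → colour y ≡ suc c)
    top? y = colour y ≟ suc c
    rest : List Y
    rest = filter (¬? ∘ top?) ys
    ≤c : All (λ y → colour y ≤ c) rest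
    ≤c = All.zipWith (λ (≤c+1 , ≢c+1) → ≤-pred (≤∧≢⇒< ≤c+1 ≢c+1))
           (filter⁺ (¬? ∘ top?) ≤c+1 , all-filter (¬? ∘ top?) ys)
    rest-long : suc c * m ≤ length rest
    rest-long = +-cancelˡ-≤ m _ _ (begin
      m + suc c * m                          ≤⟨ m≤ ⟩
      length ys                              ≡⟨ length-filter-¬ top? ys ⟨
      length (filter top? ys) + length rest  ≤⟨ +-monoˡ-≤ (length rest) (<⇒≤ (≰⇒> short)) ⟩
      m + length rest                        ∎)
      where open ≤-Reasoning

  Homogeneous : (List X → ℕ) → ℕ → List X → ℕ → Set
  Homogeneous χ K H c = ∀ {A} → A ⊆ H → length A ≡ K → χ A ≡ c

  homogeneous-⊆ : ∀ {χ : List X → ℕ} {K H H′ c} → H′ ⊆ H →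
                  Homogeneous χ K H c → Homogeneous χ K H′ c
  homogeneous-⊆ H′⊆H hom A⊆H′ = hom (⊆-trans A⊆H′ H′⊆H)

  homogeneous-zero : ∀ {χ : List X → ℕ} {H} → Homogeneous χ 0 H (χ [])
  homogeneous-zero {A = []} _ refl = refl

  data EndHomogeneous (χ : List X → ℕ) (K : ℕ) : List (X × ℕ) → Set where
    []  : EndHomogeneous χ K []
    _∷_ : ∀ {x c ps} → Homogeneous (χ ∘ (x ∷_)) K (map proj₁ ps) c →
          EndHomogeneous χ K ps → EndHomogeneous χ K ((x , c) ∷ ps)

  endHomogeneous-⊆ : ∀ {χ : List X → ℕ} {K ps ps′} → ps′ ⊆ ps →
                     EndHomogeneous χ K ps → EndHomogeneous χ K ps′
  endHomogeneous-⊆ []            []          = []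
  endHomogeneous-⊆ (_ ∷ʳ ps′⊆)   (_ ∷ end)   = endHomogeneous-⊆ ps′⊆ end
  endHomogeneous-⊆ (refl ∷ ps′⊆) (hom ∷ end) =
    homogeneous-⊆ (map⁺ proj₁ ps′⊆) hom ∷ endHomogeneous-⊆ ps′⊆ end

  endHomogeneous⇒homogeneous : ∀ {χ : List X → ℕ} {K c ps} → EndHomogeneous χ K ps →
    All (λ p → proj₂ p ≡ c) ps → Homogeneous χ (suc K) (map proj₁ ps) c
  endHomogeneous⇒homogeneous [] [] [] ()
  endHomogeneous⇒homogeneous (_ ∷ end) (_ ∷ mono) (_ ∷ʳ A⊆)  = endHomogeneous⇒homogeneous end mono A⊆
  endHomogeneous⇒homogeneous (hom ∷ _) (refl ∷ _) (refl ∷ A⊆) = hom A⊆ ∘ suc-injective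

  mutual
    ramseyBound : ℕ → ℕ → ℕ → ℕ
    ramseyBound zero    c m = m
    ramseyBound (suc K) c m = endHomogeneousBound K c (suc c * m)

    endHomogeneousBound : ℕ → ℕ → ℕ → ℕ
    endHomogeneousBound K c zero    = 0
    endHomogeneousBound K c (suc p) = suc (ramseyBound K c (endHomogeneousBound K c p))

  module _ {c : ℕ} where

    -- Erdős–Rado: greedily build a long end-homogeneous sequence, then apply the pigeonhole
    -- principle to the colours it records.
    mutual
      ramsey : (χ : List X → ℕ) → (∀ A → χ A ≤ c) → ∀ K m {H} → ramseyBound K c m ≤ length H →
               ∃ λ H′ → H′ ⊆ H × m ≤ length H′ × ∃ λ col → col ≤ c × Homogeneous χ K H′ col
      ramsey χ χ≤c zero m {H} m≤ = H , ⊆-refl , m≤ , χ [] , χ≤c [] , homogeneous-zero {χ = χ}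
      ramsey χ χ≤c (suc K) m H-long =
        let ps , ps⊆ , ps-long , end , ≤c = endHomogeneousSublist χ χ≤c K (suc c * m) H-long
            col , col≤c , qs , qs⊆ , mono , qs-long = pigeonhole proj₂ c m ps ≤c ps-long
        in map proj₁ qs , ⊆-trans (map⁺ proj₁ qs⊆) ps⊆ ,
           subst (m ≤_) (sym (length-map proj₁ qs)) qs-long ,
           col , col≤c , endHomogeneous⇒homogeneous (endHomogeneous-⊆ qs⊆ end) mono

      endHomogeneousSublist : (χ : List X → ℕ) → (∀ A → χ A ≤ c) → ∀ K p {H} →
        endHomogeneousBound K c p ≤ length H →
        ∃ λ ps → map proj₁ ps ⊆ H × p ≤ length ps × EndHomogeneous χ K ps × All (λ p → proj₂ p ≤ c) ps
      endHomogeneousSublist χ χ≤c K zero {H} _ = [] , minimum H , z≤n , [] , []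
      endHomogeneousSublist χ χ≤c K (suc p) {x ∷ H} (s≤s H-long) =
        let H′ , H′⊆ , H′-long , col , col≤c , hom = ramsey (χ ∘ (x ∷_)) (χ≤c ∘ (x ∷_)) K _ H-long
            ps , ps⊆ , ps-long , end , ≤c = endHomogeneousSublist χ χ≤c K p H′-long
        in (x , col) ∷ ps , refl ∷ ⊆-trans ps⊆ H′⊆ , s≤s ps-long ,
           homogeneous-⊆ ps⊆ hom ∷ end , col≤c ∷ ≤c

  simultaneousBound : (J → ℕ) → ℕ → List J → ℕ → ℕ
  simultaneousBound arity c js m = foldr (λ j → ramseyBound (arity j) c) m js

  simultaneousRamsey : (arity : J → ℕ) (χ : J → List X → ℕ) {c : ℕ} → (∀ j A → χ j A ≤ c) →
    ∀ js m {H} → simultaneousBound arity c js m ≤ length H →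
    ∃ λ H′ → H′ ⊆ H × m ≤ length H′ × (∀ {j} → j ∈ js → ∃ λ col → Homogeneous (χ j) (arity j) H′ col)
  simultaneousRamsey arity χ χ≤c [] m {H} m≤ = H , ⊆-refl , m≤ , λ ()
  simultaneousRamsey arity χ χ≤c (j ∷ js) m H-long =
    let H₁ , H₁⊆ , H₁-long , col , _ , hom = ramsey (χ j) (χ≤c j) (arity j) _ H-long
        H′ , H′⊆ , H′-long , homs = simultaneousRamsey arity χ χ≤c js m H₁-long
    in H′ , ⊆-trans H′⊆ H₁⊆ , H′-long , λ where
         (here refl) → col , homogeneous-⊆ H′⊆ hom
         (there j∈)  → homs j∈

module Subsets where

  open import Data.Nat using (ℕ; suc; _+_; _≤_; z≤n; s≤s)
  open import Data.Nat.Properties using (≤-trans; ≤-reflexive; +-suc; +-monoʳ-≤; n≤1+n; +-mono-≤)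
  open import Data.Empty using (⊥-elim)
  open import Data.Fin using (Fin)
  open import Data.Fin.Subset using (Subset; _∈_; ∣_∣; _∪_; ⁅_⁆; ⋃; inside; outside)
  open import Data.Fin.Subset.Properties
    using (∣⊥∣≡0; ∣⁅x⁆∣≡1; x∈⁅x⁆; x∈⁅y⁆⇒x≡y; ∉⊥; x∈p∪q⁺; x∈p∪q⁻; x∈p∧x≢y⇒x∈p-y; x∈p⇒∣p-x∣<∣p∣)
  open import Data.List using (List; []; _∷_; length; map)
  open import Data.List.Membership.Propositional using () renaming (_∈_ to _∈ₗ_)
  open import Data.List.Relation.Unary.All as All using (All; []; _∷_)
  open import Data.List.Relation.Unary.Any using (here; there)
  open import Data.List.Relation.Unary.AllPairs using ([]; _∷_)
  open import Data.List.Relation.Unary.Unique.Propositional using (Unique)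
  open import Data.Product using (_,_)
  open import Data.Sum using (inj₁; inj₂)
  open import Data.Vec using ([]; _∷_)
  open import Function using (_∘_)
  open import Relation.Binary.PropositionalEquality using (refl; sym; subst)

  private variable N : ℕ

  ∣p∪q∣≤∣p∣+∣q∣ : (p q : Subset N) → ∣ p ∪ q ∣ ≤ ∣ p ∣ + ∣ q ∣
  ∣p∪q∣≤∣p∣+∣q∣ []            []            = z≤n
  ∣p∪q∣≤∣p∣+∣q∣ (inside ∷ p)  (inside ∷ q)  =
    s≤s (≤-trans (∣p∪q∣≤∣p∣+∣q∣ p q) (+-monoʳ-≤ ∣ p ∣ (n≤1+n _)))
  ∣p∪q∣≤∣p∣+∣q∣ (inside ∷ p)  (outside ∷ q) = s≤s (∣p∪q∣≤∣p∣+∣q∣ p q)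
  ∣p∪q∣≤∣p∣+∣q∣ (outside ∷ p) (inside ∷ q)  =
    subst (suc ∣ p ∪ q ∣ ≤_) (sym (+-suc ∣ p ∣ ∣ q ∣)) (s≤s (∣p∪q∣≤∣p∣+∣q∣ p q))
  ∣p∪q∣≤∣p∣+∣q∣ (outside ∷ p) (outside ∷ q) = ∣p∪q∣≤∣p∣+∣q∣ p q

  fromList : List (Fin N) → Subset N
  fromList xs = ⋃ (map ⁅_⁆ xs)

  ∈-fromList⁺ : ∀ {x : Fin N} {xs} → x ∈ₗ xs → x ∈ fromList xs
  ∈-fromList⁺ {xs = y ∷ _} (here refl) = x∈p∪q⁺ (inj₁ (x∈⁅x⁆ y))
  ∈-fromList⁺ (there x∈)              = x∈p∪q⁺ (inj₂ (∈-fromList⁺ x∈))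

  ∈-fromList⁻ : ∀ {x : Fin N} xs → x ∈ fromList xs → x ∈ₗ xs
  ∈-fromList⁻ []       x∈ = ⊥-elim (∉⊥ x∈)
  ∈-fromList⁻ (y ∷ xs) x∈ with x∈p∪q⁻ ⁅ y ⁆ (fromList xs) x∈
  ... | inj₁ x∈⁅y⁆ = here (x∈⁅y⁆⇒x≡y y x∈⁅y⁆)
  ... | inj₂ x∈xs  = there (∈-fromList⁻ xs x∈xs)

  ∣fromList∣≤length : (xs : List (Fin N)) → ∣ fromList xs ∣ ≤ length xs
  ∣fromList∣≤length {N} []       = ≤-reflexive (∣⊥∣≡0 N)
  ∣fromList∣≤length     (x ∷ xs) = ≤-trans (∣p∪q∣≤∣p∣+∣q∣ ⁅ x ⁆ (fromList xs))
    (+-mono-≤ (≤-reflexive (∣⁅x⁆∣≡1 x)) (∣fromList∣≤length xs))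

  length≤∣p∣ : ∀ {xs} {p : Subset N} → Unique xs → All (_∈ p) xs → length xs ≤ ∣ p ∣
  length≤∣p∣ [] [] = z≤n
  length≤∣p∣ (x∉xs ∷ unique) (x∈p ∷ xs⊆p) =
    ≤-trans (s≤s (length≤∣p∣ unique (All.zipWith (λ (y∈p , x≢y) → x∈p∧x≢y⇒x∈p-y y∈p (x≢y ∘ sym))
                                                  (xs⊆p , x∉xs))))
            (x∈p⇒∣p-x∣<∣p∣ x∈p)

  length≤∣fromList∣ : ∀ {xs : List (Fin N)} → Unique xs → length xs ≤ ∣ fromList xs ∣
  length≤∣fromList∣ unique = length≤∣p∣ unique (All.tabulate ∈-fromList⁺)

  unique⇒length≤ : ∀ {xs ys : List (Fin N)} → Unique xs → All (_∈ₗ ys) xs → length xs ≤ length ys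
  unique⇒length≤ {ys = ys} unique xs⊆ys =
    ≤-trans (length≤∣p∣ unique (All.map ∈-fromList⁺ xs⊆ys)) (∣fromList∣≤length ys)

module Lists where

  open import Data.Nat using (ℕ; zero; suc; _*_; _^_; _≤_; s≤s; z≤n)
  open import Data.Nat.Properties using (≤-refl; +-mono-≤)
  open import Data.List using (List; []; _∷_; [_]; length; map; concatMap; upTo; allFin)
  open import Data.List.Properties using (length-++; length-map; length-tabulate)
  open import Data.List.Membership.Propositional using (_∈_; lose)
  open import Data.List.Membership.Propositional.Properties using (∈-concatMap⁺; ∈-map⁺; ∈-map⁻; ∈-upTo⁺)
  open import Data.List.Relation.Unary.All using (All; []; _∷_)
  open import Data.List.Relation.Unary.Any using (here)
  open import Data.List.Relation.Unary.AllPairs using ([]; _∷_)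
  open import Data.List.Relation.Unary.Unique.Propositional using (Unique)
  open import Data.List.Relation.Binary.Sublist.Propositional using (_⊆_; []; _∷_; _∷ʳ_)
  open import Data.List.Relation.Binary.Sublist.Propositional.Properties using (All-resp-⊆)
  open import Data.Product using (∃; _×_; _,_)
  open import Data.Vec using (Vec; []; _∷_; toList)
  open import Function using (id)
  open import Relation.Binary.PropositionalEquality using (_≡_; refl; sym; cong; subst)

  private variable X Y : Set

  length-allFin : ∀ n → length (allFin n) ≡ n
  length-allFin n = length-tabulate id

  Unique-resp-⊆ : ∀ {xs ys : List X} → xs ⊆ ys → Unique ys → Unique xs
  Unique-resp-⊆ []           []            = []
  Unique-resp-⊆ (_ ∷ʳ xs⊆)   (_ ∷ unique)  = Unique-resp-⊆ xs⊆ unique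
  Unique-resp-⊆ (refl ∷ xs⊆) (x∉ ∷ unique) = All-resp-⊆ xs⊆ x∉ ∷ Unique-resp-⊆ xs⊆ unique

  ∈-concatMap : ∀ {f : X → List Y} {x xs y} → x ∈ xs → y ∈ f x → y ∈ concatMap f xs
  ∈-concatMap {f = f} x∈ y∈ = ∈-concatMap⁺ f (lose x∈ y∈)

  length-concatMap-≤ : ∀ {f : X → List Y} {b} (xs : List X) → (∀ x → length (f x) ≤ b) →
                       length (concatMap f xs) ≤ length xs * b
  length-concatMap-≤ [] _ = z≤n
  length-concatMap-≤ {f = f} (x ∷ xs) f≤b =
    subst (_≤ _) (sym (length-++ (f x))) (+-mono-≤ (f≤b x) (length-concatMap-≤ xs f≤b))

  All-∈-map⁻ : ∀ {f : X → Y} {xs ys} → All (_∈ map f xs) ys → ∃ λ ws → All (_∈ xs) ws × ys ≡ map f ws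
  All-∈-map⁻ [] = [] , [] , refl
  All-∈-map⁻ {f = f} (y∈ ∷ ys⊆) with w , w∈ , refl ← ∈-map⁻ f y∈ | ws , ws⊆ , ys≡ ← All-∈-map⁻ ys⊆ =
    w ∷ ws , w∈ ∷ ws⊆ , cong (f w ∷_) ys≡

  tuples : ℕ → List X → List (List X)
  tuples zero    xs = [ [] ]
  tuples (suc a) xs = concatMap (λ x → map (x ∷_) (tuples a xs)) xs

  ∈-tuples : ∀ {xs τ : List X} → All (_∈ xs) τ → τ ∈ tuples (length τ) xs
  ∈-tuples []           = here refl
  ∈-tuples (x∈ ∷ τ⊆xs) = ∈-concatMap x∈ (∈-map⁺ _ (∈-tuples τ⊆xs))

  length-tuples : ∀ a (xs : List X) → length (tuples a xs) ≤ length xs ^ a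
  length-tuples zero    xs = ≤-refl
  length-tuples (suc a) xs = length-concatMap-≤ xs λ x →
    subst (_≤ _) (sym (length-map (x ∷_) (tuples a xs))) (length-tuples a xs)

  tuplesUpTo : ℕ → List X → List (List X)
  tuplesUpTo m xs = concatMap (λ a → tuples a xs) (upTo (suc m))

  ∈-tuplesUpTo : ∀ {m} {xs τ : List X} → length τ ≤ m → All (_∈ xs) τ → τ ∈ tuplesUpTo m xs
  ∈-tuplesUpTo {xs = xs} τ≤m τ⊆xs = ∈-concatMap {f = λ a → tuples a xs} (∈-upTo⁺ (s≤s τ≤m)) (∈-tuples τ⊆xs)

  fit : (len : ℕ) → List ℕ → Vec ℕ len
  fit zero      _        = []
  fit (suc len) []       = 0 ∷ fit len []
  fit (suc len) (x ∷ xs) = x ∷ fit len xs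

  fit-toList : ∀ {len} (x : Vec ℕ len) → fit len (toList x) ≡ x
  fit-toList []      = refl
  fit-toList (x ∷ v) = cong (x ∷_) (fit-toList v)

module Patterns {N : ℕ} where

  open import Data.Nat using (ℕ; zero; suc; _<_; _≤_; _^_; s≤s)
  open import Data.Fin using (Fin; toℕ)
  open import Data.Fin.Properties using (toℕ<n; _≟_)
  open import Data.List using (List; []; _∷_; length; map; filter; take; upTo)
  open import Data.List.Properties using (length-map; length-upTo)
  open import Data.List.Membership.Propositional using (_∈_)
  open import Data.List.Membership.Propositional.Properties using (∈-filter⁺; ∈-map⁺; ∈-upTo⁺)
  open import Data.List.Membership.DecPropositional (_≟_ {N}) using (_∈?_)
  open import Data.List.Relation.Unary.All as All using (All; []; _∷_)
  open import Data.List.Relation.Unary.All.Properties using (all-filter)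
  open import Data.List.Relation.Unary.Any as Any using (here; there)
  open import Data.List.Relation.Unary.Unique.Propositional using (Unique)
  import Data.List.Relation.Unary.Unique.Propositional.Properties as Unique
  open import Data.List.Relation.Binary.Sublist.Propositional using (_⊆_)
  open import Data.List.Relation.Binary.Sublist.Propositional.Properties using (filter-⊆)
  open import Data.Product using (∃; _×_; _,_; proj₁; proj₂)
  open import Data.Vec using (Vec)
  open import Function using (id)
  open import Relation.Binary.PropositionalEquality using (_≡_; refl; sym; trans; subst; cong; cong₂)
  open Subsets using (unique⇒length≤)
  open Lists using (All-∈-map⁻; tuples; ∈-tuples; length-tuples; fit)

  -- Out-of-range positions read as 0.
  labelAt : List (Fin N) → ℕ → ℕ
  labelAt []      _       = 0
  labelAt (a ∷ _) zero    = toℕ a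
  labelAt (_ ∷ A) (suc i) = labelAt A i

  labelAt-take : ∀ {k i} (A : List (Fin N)) → i < k → labelAt (take k A) i ≡ labelAt A i
  labelAt-take {suc k}         []      _         = refl
  labelAt-take {suc k} {zero}  (a ∷ A) _         = refl
  labelAt-take {suc k} {suc i} (a ∷ A) (s≤s i<k) = labelAt-take A i<k

  labelAt-index : ∀ {x A} (x∈A : x ∈ A) → labelAt A (toℕ (Any.index x∈A)) ≡ toℕ x
  labelAt-index (here refl) = refl
  labelAt-index (there x∈A) = labelAt-index x∈A

  positionsIn : ∀ {A ws} → All (_∈ A) ws →
                ∃ λ τ → All (_< length A) τ × map toℕ ws ≡ map (labelAt A) τ
  positionsIn [] = [] , [] , refl
  positionsIn (w∈A ∷ ws⊆A) =
    let τ , τ< , spells = positionsIn ws⊆A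
    in toℕ (Any.index w∈A) ∷ τ , toℕ<n _ ∷ τ< , cong₂ _∷_ (sym (labelAt-index w∈A)) spells

  record Pattern (H : List (Fin N)) (xs : List ℕ) : Set where
    field
      support    : List (Fin N)
      support⊆H  : support ⊆ H
      support≤   : length support ≤ length xs
      positions  : List ℕ
      positions< : All (_< length support) positions
      spells     : xs ≡ map (labelAt support) positions

    length-positions : length positions ≡ length xs
    length-positions = trans (sym (length-map (labelAt support) positions)) (cong length (sym spells))

  patternOf : ∀ {H xs} → Unique H → All (_∈ map toℕ H) xs → Pattern H xs
  patternOf {H} unique xs⊆H with ws , ws⊆H , refl ← All-∈-map⁻ xs⊆H = record
    { support    = A
    ; support⊆H  = filter-⊆ (_∈? ws) H
    ; support≤   = subst (length A ≤_) (sym (length-map toℕ ws))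
                     (unique⇒length≤ (Unique.filter⁺ (_∈? ws) unique) (all-filter (_∈? ws) H))
    ; positions  = proj₁ (positionsIn ws⊆A)
    ; positions< = proj₁ (proj₂ (positionsIn ws⊆A))
    ; spells     = proj₂ (proj₂ (positionsIn ws⊆A))
    }
    where
    A : List (Fin N)
    A = filter (_∈? ws) H
    ws⊆A : All (_∈ A) ws
    ws⊆A = All.zipWith (λ (w∈H , w∈ws) → ∈-filter⁺ (_∈? ws) w∈H w∈ws) (ws⊆H , All.tabulate id)

  patternOutputs : ∀ {Y : Set} {len} → List (Fin N) → (Vec ℕ len → Y) → List Y
  patternOutputs {len = len} H f = map (λ τ → f (fit len (map (labelAt H) τ))) (tuples len (upTo len))

  ∈-patternOutputs : ∀ {Y : Set} {len τ} (H : List (Fin N)) (f : Vec ℕ len → Y) →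
                     length τ ≡ len → All (_< len) τ → f (fit len (map (labelAt H) τ)) ∈ patternOutputs H f
  ∈-patternOutputs H f refl τ<len = ∈-map⁺ _ (∈-tuples (All.map ∈-upTo⁺ τ<len))

  length-patternOutputs : ∀ {Y : Set} {len} (H : List (Fin N)) (f : Vec ℕ len → Y) →
                          length (patternOutputs H f) ≤ len ^ len
  length-patternOutputs {len = len} H f =
    subst (_≤ len ^ len) (sym (length-map _ (tuples len (upTo len))))
      (subst (λ b → length (tuples len (upTo len)) ≤ b ^ len) (length-upTo len)
        (length-tuples len (upTo len)))

module QueryBounds where

  open import Defs using (ballSize)
  open import Data.Nat using (ℕ; zero; suc; _+_; _*_; _^_; _≤_; _<_; z≤n; s≤s; _≤ᵇ_)
  open import Data.Nat.Properties
  open import Data.Nat.Tactic.RingSolver using (solve-∀)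
  open import Data.Unit using (tt)
  open import Relation.Binary.PropositionalEquality using (_≡_; sym; cong; subst)

  -- A node at depth d reads d balls, so its input takes at most (d * ballSize q) ^ (d * ballSize q)
  -- patterns, each leading to one query and one subtree.
  queryBound : ℕ → ℕ → ℕ → ℕ
  queryBound q d zero    = 0
  queryBound q d (suc k) = (d * ballSize q) ^ (d * ballSize q) * suc (queryBound q (suc d) k)

  n<2^n : ∀ n → n < 2 ^ n
  n<2^n zero    = s≤s z≤n
  n<2^n (suc n) = subst (suc n <_) (cong (2 ^ n +_) (sym (+-identityʳ (2 ^ n))))
                    (+-mono-≤ (m^n>0 2 n) (n<2^n n))

  1≤^ : ∀ {x} k → 1 ≤ x → 1 ≤ x ^ k
  1≤^ {x} k 1≤x = subst (_≤ x ^ k) (^-zeroˡ k) (^-monoˡ-≤ k 1≤x)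

  0<n^n : ∀ n → 0 < n ^ n
  0<n^n zero    = s≤s z≤n
  0<n^n (suc n) = m^n>0 (suc n) (suc n)

  ^-mono-self : ∀ {a c} → a ≤ c → a ^ a ≤ c ^ c
  ^-mono-self {a} {zero}  z≤n = ≤-refl
  ^-mono-self {a} {suc c} a≤c = ≤-trans (^-monoˡ-≤ a a≤c) (^-monoʳ-≤ (suc c) a≤c)

  *-≤-2^ : ∀ {a b} e f → a ≤ 2 ^ e → b ≤ 2 ^ f → a * b ≤ 2 ^ (e + f)
  *-≤-2^ {a} {b} e f a≤ b≤ = subst (a * b ≤_) (sym (^-distribˡ-+-* 2 e f)) (*-mono-≤ a≤ b≤)

  ^-≤-2^ : ∀ {a} e c → a ≤ 2 ^ e → a ^ c ≤ 2 ^ (e * c)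
  ^-≤-2^ {a} e c a≤ = subst (a ^ c ≤_) (^-*-assoc 2 e c) (^-monoˡ-≤ c a≤)

  module _ (q : ℕ) where

    maxArity : ℕ
    maxArity = q * ballSize q

    roundFactor : ℕ
    roundFactor = 2 * maxArity ^ maxArity

    queryBound≤ : ∀ d k → d + k ≤ suc q → queryBound q d k ≤ roundFactor ^ k
    queryBound≤ d zero    _    = z≤n
    queryBound≤ d (suc k) d+k≤ = begin
      (d * ballSize q) ^ (d * ballSize q) * suc (queryBound q (suc d) k)
        ≤⟨ *-mono-≤ (^-mono-self (*-monoˡ-≤ (ballSize q) d≤q)) (+-mono-≤ one ih) ⟩
      maxArity ^ maxArity * (roundFactor ^ k + roundFactor ^ k)
        ≡⟨ rearrange (maxArity ^ maxArity) (roundFactor ^ k) ⟩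
      roundFactor ^ suc k ∎
      where
      open ≤-Reasoning
      d+k≤q : d + k ≤ q
      d+k≤q = ≤-pred (subst (_≤ suc q) (+-suc d k) d+k≤)
      d≤q : d ≤ q
      d≤q = ≤-trans (m≤m+n d k) d+k≤q
      ih : queryBound q (suc d) k ≤ roundFactor ^ k
      ih = queryBound≤ (suc d) k (s≤s d+k≤q)
      one : 1 ≤ roundFactor ^ k
      one = 1≤^ k (*-mono-≤ {1} {2} (s≤s z≤n) (0<n^n maxArity))
      rearrange : ∀ x y → x * (y + y) ≡ 2 * x * y
      rearrange = solve-∀

  -- The slack is q ^ 6 minus the left-hand side, expanded at q = 3 + s.
  exponent-slack : ∀ s →
    suc (((3 + s) + suc (3 + s)) * ((3 + s) * (2 * (3 + s) + 1))) * (3 + s) + (3 + s) * 5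
      + (270 + 906 * s + 962 * (s * s) + 488 * (s * s * s) + 131 * (s * s * s * s)
         + 18 * (s * s * s * s * s) + s * s * s * s * s * s)
    ≡ (3 + s) * ((3 + s) * ((3 + s) * ((3 + s) * ((3 + s) * ((3 + s) * 1)))))
  exponent-slack = solve-∀

  exponent≤ : ∀ s → let q = 3 + s in suc ((q + suc q) * maxArity q) * q + q * 5 ≤ q ^ 6
  exponent≤ s = subst (suc ((q + suc q) * maxArity q) * q + q * 5 ≤_) (exponent-slack s) (m≤m+n _ _)
    where
    q : ℕ
    q = 3 + s

  queryBound*q^5≤ : ∀ q → 2 ≤ q → queryBound q 1 q * q ^ 5 ≤ 2 ^ (q ^ 6)
  queryBound*q^5≤ 0 ()
  queryBound*q^5≤ 1 (s≤s ())
  -- Here the estimate through roundFactor is too weak; the inequality is decided by evaluation.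
  queryBound*q^5≤ 2 _ = ≤ᵇ⇒≤ _ _ tt
  queryBound*q^5≤ (suc (suc (suc s))) _ = begin
    queryBound q 1 q * q ^ 5       ≤⟨ *-monoˡ-≤ (q ^ 5) (queryBound≤ q 1 q ≤-refl) ⟩
    roundFactor q ^ q * q ^ 5
      ≤⟨ *-≤-2^ (suc (E * M) * q) (q * 5) (^-≤-2^ (suc (E * M)) q X≤) (^-≤-2^ q 5 q≤) ⟩
    2 ^ (suc (E * M) * q + q * 5)  ≤⟨ ^-monoʳ-≤ 2 (exponent≤ s) ⟩
    2 ^ (q ^ 6)                    ∎
    where
    open ≤-Reasoning
    q M E : ℕ
    q = 3 + s
    M = maxArity q
    E = q + suc q
    q≤ : q ≤ 2 ^ q
    q≤ = <⇒≤ (n<2^n q)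
    b≤ : ballSize q ≤ 2 ^ suc q
    b≤ = ≤-trans (m≤m+n (2 * q + 1) 1) (subst (_≤ 2 ^ suc q) (double-suc q) (*-monoʳ-≤ 2 (n<2^n q)))
      where
      double-suc : ∀ x → 2 * suc x ≡ 2 * x + 1 + 1
      double-suc = solve-∀
    X≤ : roundFactor q ≤ 2 ^ suc (E * M)
    X≤ = *-≤-2^ 1 (E * M) ≤-refl (^-≤-2^ E M (*-≤-2^ q (suc q) q≤ b≤))

  indexBudget : ∀ {m n} q r → m ≤ n → m ≤ 2 ^ r * queryBound q 1 q → 2 ^ (r + q ^ 6) < n → m * q ^ 5 ≤ n
  indexBudget {m} {n} 0 r _   _ _ = subst (_≤ n) (sym (*-zeroʳ m)) z≤n
  indexBudget {m} {n} 1 r m≤n _ _ = subst (_≤ n) (sym (*-identityʳ m)) m≤n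
  indexBudget {m} {n} q@(suc (suc _)) r _ m≤ budget = begin
    m * q ^ 5                          ≤⟨ *-monoˡ-≤ (q ^ 5) m≤ ⟩
    2 ^ r * queryBound q 1 q * q ^ 5   ≡⟨ *-assoc (2 ^ r) _ _ ⟩
    2 ^ r * (queryBound q 1 q * q ^ 5) ≤⟨ *-monoʳ-≤ (2 ^ r) (queryBound*q^5≤ q (s≤s (s≤s z≤n))) ⟩
    2 ^ r * 2 ^ (q ^ 6)                ≡⟨ ^-distribˡ-+-* 2 r (q ^ 6) ⟨
    2 ^ (r + q ^ 6)                    <⟨ budget ⟩
    n                                  ∎
    where open ≤-Reasoning

module DecisionTrees {n q : ℕ} where

  open import Defs using (DT; leaf; node; ballSize; ball; Uses; here; there)
  open import Data.Nat using (ℕ; _+_; _*_; _^_; _≤_; _<_; z≤n; s≤s)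
  open import Data.Nat.Properties using (≤-trans; +-suc; *-monoˡ-≤)
  open import Data.Fin using (Fin)
  open import Data.List using (List; []; _∷_; length; concatMap)
  open import Data.List.Membership.Propositional using (_∈_)
  open import Data.List.Relation.Unary.Any using (here; there)
  open import Data.Maybe using (Maybe; just; nothing)
  open import Data.Product using (Σ; _×_; _,_)
  open import Data.Vec using (Vec; concat; map)
  open import Data.Vec.Relation.Unary.All using (universal) renaming (All to AllV)
  open import Data.Vec.Relation.Unary.All.Properties using (concat⁺; map⁺)
  open import Relation.Binary.PropositionalEquality using (_≡_; refl; cong; trans)
  open Lists using (∈-concatMap; length-concatMap-≤)
  open QueryBounds using (queryBound)

  NodeFunction : Set
  NodeFunction = Σ ℕ λ len → (Vec ℕ len → Fin n)

  nodeAt : ∀ {d k} → DT n q d k → List (Fin n) → Maybe NodeFunction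
  nodeAt (leaf _)    _       = nothing
  nodeAt (node f _)  []      = just (_ , f)
  nodeAt (node _ ch) (j ∷ P) = nodeAt (ch j) P

  nodeAt-shape : ∀ {d k} (tr : DT n q d k) P {len f} → nodeAt tr P ≡ just (len , f) →
                 length P < k × len ≡ (length P + d) * ballSize q
  nodeAt-shape     (leaf _)    _       ()
  nodeAt-shape     (node _ _)  []      refl = s≤s z≤n , refl
  nodeAt-shape {d} (node _ ch) (j ∷ P) at with P<k , len≡ ← nodeAt-shape (ch j) P at =
    s≤s P<k , trans len≡ (cong (_* ballSize q) (+-suc (length P) d))

  module _ (outputs : ∀ {len} → (Vec ℕ len → Fin n) → List (Fin n)) where

    candidates : ∀ {d k} → DT n q d k → List (Fin n)
    candidates (leaf _)    = []
    candidates (node f ch) = concatMap (λ i → i ∷ candidates (ch i)) (outputs f)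

    length-candidates : (∀ {len} (f : Vec ℕ len → Fin n) → length (outputs f) ≤ len ^ len) →
                        ∀ {d k} (tr : DT n q d k) → length (candidates tr) ≤ queryBound q d k
    length-candidates outputs≤ (leaf _)    = z≤n
    length-candidates outputs≤ (node f ch) =
      ≤-trans (length-concatMap-≤ (outputs f) λ i → s≤s (length-candidates outputs≤ (ch i)))
              (*-monoˡ-≤ _ (outputs≤ f))

    Predicts : (ℕ → Set) → ∀ {d k} → DT n q d k → Set
    Predicts Admissible tr = ∀ P {len f} → nodeAt tr P ≡ just (len , f) →
                             ∀ x → AllV Admissible x → f x ∈ outputs f

    uses⇒∈candidates : ∀ {N cyc} {L : Fin n → Fin N} {Admissible} →
      (∀ v → AllV Admissible (ball q cyc L v)) →
      ∀ {d k} {tr : DT n q d k} {seeds i} → Predicts Admissible tr → Uses cyc L tr seeds i →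
      i ∈ candidates tr
    uses⇒∈candidates {cyc = cyc} {L} {Admissible} balls = go
      where
      input-admissible : ∀ {d} (seeds : Vec (Fin n) d) → AllV Admissible (concat (map (ball q cyc L) seeds))
      input-admissible seeds = concat⁺ (map⁺ (universal balls seeds))

      go : ∀ {d k} {tr : DT n q d k} {seeds i} → Predicts Admissible tr → Uses cyc L tr seeds i →
           i ∈ candidates tr
      go {seeds = seeds} predicts (here refl) =
        ∈-concatMap (predicts [] refl _ (input-admissible seeds)) (here refl)
      go {seeds = seeds} predicts (there u) =
        ∈-concatMap (predicts [] refl _ (input-admissible seeds)) (there (go (λ P → predicts (_ ∷ P)) u))

module Jobs (n q m : ℕ) where

  open import Defs using (Tree; ballSize; ball; Uses)
  open import Data.Nat using (ℕ; suc; _*_; _≤_; _<_; s≤s; z≤n)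
  open import Data.Nat.Properties using (<⇒≤; ≤-trans; ≤-reflexive; <-≤-trans; *-monoˡ-≤; m≤n⇒m⊓n≡m; +-comm)
  open import Data.Fin using (Fin; toℕ)
  open import Data.Fin.Properties using (toℕ<n; toℕ-injective)
  open import Data.List using (List; []; _∷_; length; map; take; upTo; allFin; cartesianProduct; concatMap)
  open import Data.List.Properties using (length-take; map-cong-local)
  open import Data.List.Membership.Propositional using (_∈_)
  open import Data.List.Membership.Propositional.Properties
    using (∈-allFin; ∈-upTo⁺; ∈-cartesianProduct⁺; ∈-map⁺)
  open import Data.List.Relation.Unary.All as All using (All)
  open import Data.List.Relation.Unary.Unique.Propositional using (Unique)
  open import Data.List.Relation.Binary.Sublist.Propositional using (_⊆_)
  open import Data.List.Relation.Binary.Sublist.Propositional.Properties using (take-⊆)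
  open import Data.List.Relation.Binary.Sublist.Heterogeneous.Properties using (length-mono-≤)
  open import Data.Maybe using (Maybe; just; nothing)
  open import Data.Product using (∃; _×_; _,_; proj₁; proj₂)
  open import Data.Vec using (toList; []; _∷_)
  open import Data.Vec.Properties using (length-toList)
  open import Data.Vec.Relation.Unary.All using () renaming (All to AllV)
  open import Data.Vec.Relation.Unary.All.Properties using (toList⁺; tabulate⁺)
  open import Function using (_∘_)
  open import Function.Bundles using (_↔_)
  open import Relation.Binary.PropositionalEquality
    using (_≡_; refl; sym; trans; cong; subst; module ≡-Reasoning)
  open Ramsey using (Homogeneous)
  open Lists
    using (tuplesUpTo; ∈-tuplesUpTo; fit; fit-toList; ∈-concatMap; length-concatMap-≤; length-allFin)
  open Patterns
  open QueryBounds using (queryBound; maxArity)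
  open DecisionTrees {n} {q}

  -- A job (t , P , k , τ) stands for the node at path P in tree t, fed the arrangement τ
  -- of k labels.
  Job : Set
  Job = Fin m × List (Fin n) × ℕ × List ℕ

  arity : Job → ℕ
  arity (_ , _ , k , _) = k

  jobs : List Job
  jobs = cartesianProduct (allFin m) (cartesianProduct (tuplesUpTo q (allFin n))
           (cartesianProduct (upTo (suc (maxArity q))) (tuplesUpTo (maxArity q) (upTo (maxArity q)))))

  ∈-jobs : ∀ t {P k τ} → length P ≤ q → k ≤ maxArity q → length τ ≤ maxArity q → All (_< maxArity q) τ →
           (t , P , k , τ) ∈ jobs
  ∈-jobs t P≤q k≤M τ≤M τ<M =
    ∈-cartesianProduct⁺ (∈-allFin t)
      (∈-cartesianProduct⁺ (∈-tuplesUpTo P≤q (All.tabulate λ {j} _ → ∈-allFin j))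
        (∈-cartesianProduct⁺ (∈-upTo⁺ (s≤s k≤M)) (∈-tuplesUpTo τ≤M (All.map ∈-upTo⁺ τ<M))))

  nodeAt-bounds : ∀ (tr : Tree n q) P {len f} → nodeAt tr P ≡ just (len , f) →
                  length P ≤ q × len ≤ maxArity q
  nodeAt-bounds tr P at with P<q , len≡ ← nodeAt-shape tr P at =
    <⇒≤ P<q , subst (_≤ maxArity q) (sym len≡)
                (*-monoˡ-≤ (ballSize q) (subst (_≤ q) (+-comm 1 (length P)) P<q))

  evalAt : Maybe NodeFunction → List ℕ → ℕ
  evalAt nothing          _  = 0
  evalAt (just (len , f)) xs = toℕ (f (fit len xs))

  evalAt≤n : ∀ node xs → evalAt node xs ≤ n
  evalAt≤n nothing          _  = z≤n
  evalAt≤n (just (len , f)) xs = <⇒≤ (toℕ<n (f (fit len xs)))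

  module _ {N : ℕ} (T : Fin m → Tree n q) where

    colour : Job → List (Fin N) → ℕ
    colour (t , P , _ , τ) A = evalAt (nodeAt (T t) P) (map (labelAt A) τ)

    colour≤n : ∀ j A → colour j A ≤ n
    colour≤n (t , P , _ , τ) A = evalAt≤n (nodeAt (T t) P) (map (labelAt A) τ)

    module Queries {H : List (Fin N)} (unique : Unique H)
             (homogeneous : ∀ {j} → j ∈ jobs → ∃ λ c → Homogeneous (colour j) (arity j) H c) where

      -- Homogeneity moves the support A of the input to the first length A labels of H.
      sameOutput : ∀ {t P len f A τ} → (t , P , length A , τ) ∈ jobs → nodeAt (T t) P ≡ just (len , f) →
                   A ⊆ H → All (_< length A) τ →
                   f (fit len (map (labelAt A) τ)) ≡ f (fit len (map (labelAt H) τ))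
      sameOutput {t} {P} {len} {f} {A} {τ} job∈ at A⊆H τ<k = toℕ-injective (begin
        toℕ (f (fit len (map (labelAt A) τ)))  ≡⟨ colour-at A ⟨
        colour job A                           ≡⟨ proj₂ (homogeneous job∈) A⊆H refl ⟩
        proj₁ (homogeneous job∈)               ≡⟨ proj₂ (homogeneous job∈) (take-⊆ k H) length-take-k ⟨
        colour job (take k H)                  ≡⟨ colour-at (take k H) ⟩
        toℕ (f (fit len (map (labelAt (take k H)) τ)))
          ≡⟨ cong (λ ys → toℕ (f (fit len ys))) (map-cong-local (All.map (labelAt-take H) τ<k)) ⟩
        toℕ (f (fit len (map (labelAt H) τ)))  ∎)
        where
        open ≡-Reasoning
        k : ℕ
        k = length A
        job : Job
        job = (t , P , k , τ)
        colour-at : ∀ B → colour job B ≡ toℕ (f (fit len (map (labelAt B) τ)))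
        colour-at B = cong (λ node → evalAt node (map (labelAt B) τ)) at
        length-take-k : length (take k H) ≡ k
        length-take-k = trans (length-take k H) (m≤n⇒m⊓n≡m (length-mono-≤ A⊆H))

      predicts : ∀ t → Predicts (patternOutputs H) (_∈ map toℕ H) (T t)
      predicts t P {len} {f} at x x⊆H =
        subst (_∈ patternOutputs H f) (sym f-x≡) (∈-patternOutputs H f length-τ τ<len)
        where
        open Pattern (patternOf unique (toList⁺ x⊆H))
        length-τ : length positions ≡ len
        length-τ = trans length-positions (length-toList x)
        k≤len : length support ≤ len
        k≤len = subst (length support ≤_) (length-toList x) support≤
        τ<len : All (_< len) positions
        τ<len = All.map (λ i<k → <-≤-trans i<k k≤len) positions<
        job∈ : (t , P , length support , positions) ∈ jobs
        job∈ with P≤q , len≤M ← nodeAt-bounds (T t) P at =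
          ∈-jobs t P≤q (≤-trans k≤len len≤M) (≤-trans (≤-reflexive length-τ) len≤M)
            (All.map (λ i<len → <-≤-trans i<len len≤M) τ<len)
        f-x≡ : f x ≡ f (fit len (map (labelAt H) positions))
        f-x≡ = begin
          f x                                           ≡⟨ cong f (fit-toList x) ⟨
          f (fit len (toList x))                        ≡⟨ cong (f ∘ fit len) spells ⟩
          f (fit len (map (labelAt support) positions)) ≡⟨ sameOutput job∈ at support⊆H positions< ⟩
          f (fit len (map (labelAt H) positions))       ∎
          where open ≡-Reasoning

      queried : List (Fin n)
      queried = concatMap (λ t → candidates (patternOutputs H) (T t)) (allFin m)

      length-queried : length queried ≤ m * queryBound q 1 q
      length-queried = subst (λ l → length queried ≤ l * queryBound q 1 q) (length-allFin m)
        (length-concatMap-≤ (allFin m) λ t →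
          length-candidates (patternOutputs H) (length-patternOutputs H) (T t))

      uses⇒∈queried : ∀ {cyc : Fin n ↔ Fin n} {L : Fin n → Fin N} → (∀ v → L v ∈ H) →
                      ∀ t {v₀ i} → Uses cyc L (T t) (v₀ ∷ []) i → i ∈ queried
      uses⇒∈queried {cyc} {L} L∈H t uses =
        ∈-concatMap (∈-allFin t) (uses⇒∈candidates (patternOutputs H) ball-labels (predicts t) uses)
        where
        ball-labels : ∀ v → AllV (_∈ map toℕ H) (ball q cyc L v)
        ball-labels v = tabulate⁺ λ _ → ∈-map⁺ toℕ (L∈H _)

open import Defs
open import Data.Nat using (ℕ; _+_; _*_; _^_; _≤_; _<_)
open import Data.Fin using (Fin)
open import Data.Fin.Subset using (Subset; _∈_; ∣_∣)
open import Data.Vec using (_∷_; [])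
open import Data.Product using (_×_; ∃-syntax)
open import Function.Bundles using (_↔_)
open import Function.Definitions using (Injective)
open import Relation.Binary.PropositionalEquality using (_≡_)

open import Data.Nat.Properties using (≤-trans)
open import Data.Fin.Subset.Properties using (∣p∣≤n)
open import Data.List using (allFin)
open import Data.List.Relation.Unary.Unique.Propositional.Properties using (allFin⁺)
open import Data.Product using (_,_)
open import Relation.Binary.PropositionalEquality using (sym; subst)
open Ramsey using (simultaneousBound; simultaneousRamsey)
open Subsets using (fromList; ∈-fromList⁺; ∈-fromList⁻; ∣fromList∣≤length; length≤∣fromList∣)
open Lists using (length-allFin; Unique-resp-⊆)
open QueryBounds using (indexBudget)

claim2p11 : (n q r : ℕ) → 2 ^ (r + q ^ 6) < n →
    ∃[ N₀ ] ((N : ℕ) → N₀ ≤ N →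
      (cyc : Fin n ↔ Fin n) → (T : RandOracle n q r) →
      ∃[ C ] (n ≤ ∣ C ∣ ×
        ∃[ S ] (∣ S ∣ * q ^ 5 ≤ n ×
          ((t : Fin (2 ^ r)) → (L : Fin n → Fin N) → Injective _≡_ _≡_ L →
           ((v : Fin n) → L v ∈ C) → (v₀ i : Fin n) →
           Uses cyc L (T t) (v₀ ∷ []) i → i ∈ S))))
claim2p11 n q r budget = simultaneousBound arity n jobs n , λ N N₀≤N cyc T →
  let H , H⊆allFin , n≤∣H∣ , homogeneous =
        simultaneousRamsey arity (colour T) (colour≤n T) jobs n
          (subst (_ ≤_) (sym (length-allFin N)) N₀≤N)
      unique = Unique-resp-⊆ H⊆allFin (allFin⁺ N)
      open Queries T unique homogeneous
  in  fromList H , ≤-trans n≤∣H∣ (length≤∣fromList∣ unique) ,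
      fromList queried ,
      indexBudget q r (∣p∣≤n (fromList queried)) (≤-trans (∣fromList∣≤length queried) length-queried) budget ,
      λ t L _ L∈C v₀ i uses → ∈-fromList⁺ (uses⇒∈queried (λ v → ∈-fromList⁻ H (L∈C v)) t uses)
  where open Jobs n q (2 ^ r)
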